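{- Let $n\ge1$, and suppose $S_1,\dots,S_t\subseteq\mathbb{F}_2^n$ with $\#S_i\ge2$ for each $i$. (a) If $\sum_{i=1}^tS_i=\mathbb{F}_2^n\setminus\{v\}$ for some $v\in\mathbb{F}_2^n$, then $t\le n-1$. (b) Let $e_1,\dots,e_n$ be the standard basis of $\mathbb{F}_2^n$, $v=\sum_ie_i$, and $S_i=\{0,e_1,\dots,e_n\}$ for $i=1,\dots,n-1$. Then $\sum_{i=1}^{n-1}S_i=\mathbb{F}_2^n\setminus\{v\}$.
   Context: The sumset $\sum_iS_i$ is $\{\sum_is_i: s_i\in S_i\}$. -}

module Defs where

open import Data.Bool using (Bool; true; false; _xor_)
open import Data.Nat using (ℕ; zero; suc)
open import Data.Fin using (Fin; zero; suc; _≟_)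
open import Data.Vec using (Vec; replicate; zipWith; tabulate)
open import Data.Product using (Σ; _×_; ∃; _,_)
open import Data.Sum using (_⊎_)
open import Relation.Binary.PropositionalEquality using (_≡_; _≢_)
open import Relation.Nullary using (¬_; does)

F2 : ℕ → Set
F2 n = Vec Bool n

zeroV : ∀ {n} → F2 n
zeroV = replicate _ false

_⊕_ : ∀ {n} → F2 n → F2 n → F2 n
_⊕_ = zipWith _xor_

Subset : ℕ → Set₁
Subset n = F2 n → Set

AtLeastTwo : ∀ {n} → Subset n → Set
AtLeastTwo S = Σ _ λ x → Σ _ λ y → S x × S y × x ≢ y

vsum : ∀ {n} (t : ℕ) → (Fin t → F2 n) → F2 n
vsum zero    f = zeroV
vsum (suc t) f = f zero ⊕ vsum t (λ i → f (suc i))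

Sumset : ∀ {n} (t : ℕ) → (Fin t → Subset n) → Subset n
Sumset t S w = Σ (Fin t → F2 _) λ s → ((i : Fin t) → S i (s i)) × vsum t s ≡ w

AllBut : ∀ {n} → F2 n → Subset n
AllBut v w = w ≢ v

_≐_ : ∀ {n} → Subset n → Subset n → Set
A ≐ B = ∀ w → (A w → B w) × (B w → A w)

basis : ∀ {n} → Fin n → F2 n
basis j = tabulate λ k → does (j ≟ k)

ZeroOrBasis : ∀ {n} → Subset n
ZeroOrBasis w = (w ≡ zeroV) ⊎ (Σ _ λ j → w ≡ basis j)

-- Translating, every S_i may be assumed to contain 0 together with a nonzero vector, and the claim becomes:
-- a family of at least |b| such sets in ⟨ b ⟩ never has sumset ⟨ b ⟩ ∖ {u}. Merging surplus sets, the
-- family has exactly |b| members. A Rado-type exchange argument then shows that either its sumset is all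
-- of ⟨ b ⟩, which is absurd, or some k + 1 of its sets lie in the span of k vectors y. In that case the
-- other sets are folded into one of these k + 1, keeping only those sums that land in the coset u + ⟨ y ⟩;
-- the resulting k + 1 sets have sumset ⟨ y ⟩ punctured at one point, and induction on |b| applies.
-- For (b): n - 1 vectors of weight at most one sum to a vector of weight at most n - 1, and every vector
-- other than the all-ones vector has weight at most n - 1.

module Submission where

open import Defs
open import Algebra.Bundles using (AbelianGroup)
open import Algebra.Structures using (IsAbelianGroup)
open import Data.Bool using (true; false)
open import Data.Bool.Properties using (xor-assoc; xor-comm; xor-same; xor-identityˡ; xor-identityʳ)
  renaming (_≟_ to _≟ᵇ_)
open import Data.Empty using (⊥; ⊥-elim)
open import Data.Fin using (Fin; zero; suc)
open import Data.List using (List; []; _∷_; _++_; length; map; filter; foldr; tabulate; cartesianProductWith)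
open import Data.List.Properties using (length-++; length-map; length-tabulate; ++-assoc; ++-identityʳ)
open import Data.List.Membership.Propositional using (_∈_; find; lose)
open import Data.List.Membership.Propositional.Properties
  using (∈-++⁺ˡ; ∈-++⁺ʳ; ∈-map⁺; ∈-map⁻; ∈-filter⁺; ∈-filter⁻; ∈-cartesianProductWith⁺; ∈-cartesianProductWith⁻)
open import Data.List.Relation.Binary.Permutation.Propositional
  using (_↭_; ↭-sym; prep; swap; module PermutationReasoning) renaming (refl to ↭-refl; trans to ↭-trans)
open import Data.List.Relation.Binary.Permutation.Propositional.Properties
  using (∈-resp-↭; All-resp-↭; ↭-length; shift; ++⁺ˡ; ++⁺ʳ)
import Data.List.Relation.Binary.Permutation.Propositional.Properties as ↭
open import Data.List.Relation.Unary.All as All using (All; []; _∷_)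
open import Data.List.Relation.Unary.All.Properties using (¬All⇒Any¬; ++⁻; ++⁺; tabulate⁺; map⁺)
open import Data.List.Relation.Unary.Any as Any using (Any; here; there)
open import Data.Nat using (ℕ; zero; suc; _+_; _≤_; _<_; _∸_; _≤?_; z≤n; s≤s)
open import Data.Nat.Properties
  using (≤-refl; ≤-reflexive; ≤-trans; ≤-pred; n≤1+n; m≤m+n; m≤n+m∸n; m+n≤o⇒n≤o; +-comm; +-suc; +-identityʳ;
         +-mono-≤; +-cancelʳ-≡; suc-injective; 1+n≰n; ≰⇒>; m≤n⇒m<n∨m≡n)
open import Data.Product using (Σ; ∃; ∃₂; _×_; _,_; proj₁; proj₂)
open import Data.Sum using (_⊎_; inj₁; inj₂; [_,_]′)
open import Data.Vec using ([]; _∷_; replicate)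
import Data.Vec as Vec
open import Data.Vec.Properties using (≡-dec; zipWith-assoc; zipWith-comm; zipWith-identityˡ; zipWith-identityʳ)
import Data.Vec.Functional as Vector
open import Function using (id; _∘_; _⇔_; mk⇔; Equivalence)
open import Relation.Binary.PropositionalEquality
open import Relation.Binary.PropositionalEquality.Algebra using (isMagma)
open import Relation.Nullary using (Dec; yes; no; ¬_)
open import Relation.Nullary.Decidable using (_⊎-dec_)
open import Relation.Unary using (Decidable)

⊕-self : ∀ {n} (x : F2 n) → x ⊕ x ≡ zeroV
⊕-self []      = refl
⊕-self (a ∷ x) = cong₂ _∷_ (xor-same a) (⊕-self x)

⊕-isAbelianGroup : ∀ n → IsAbelianGroup _≡_ (_⊕_ {n}) zeroV id
⊕-isAbelianGroup n = record
  { isGroup = record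
    { isMonoid = record
      { isSemigroup = record { isMagma = isMagma _⊕_ ; assoc = zipWith-assoc xor-assoc }
      ; identity    = zipWith-identityˡ xor-identityˡ , zipWith-identityʳ xor-identityʳ
      }
    ; inverse  = ⊕-self , ⊕-self
    ; ⁻¹-cong  = cong id
    }
  ; comm = zipWith-comm xor-comm
  }

⊕-abelianGroup : ℕ → AbelianGroup _ _
⊕-abelianGroup n = record { isAbelianGroup = ⊕-isAbelianGroup n }

module _ {n : ℕ} where
  open AbelianGroup (⊕-abelianGroup n) public
    using () renaming (assoc to ⊕-assoc; comm to ⊕-comm; identityˡ to ⊕-identityˡ; identityʳ to ⊕-identityʳ)
  open import Algebra.Properties.AbelianGroup (⊕-abelianGroup n)
  open import Algebra.Properties.CommutativeSemigroup (AbelianGroup.commutativeSemigroup (⊕-abelianGroup n))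
    using (interchange; x∙yz≈y∙xz)

  ⊕-cancelˡ : (x y : F2 n) → x ⊕ (x ⊕ y) ≡ y
  ⊕-cancelˡ = \\-leftDividesʳ

  ⊕-interchange : (a b c d : F2 n) → (a ⊕ b) ⊕ (c ⊕ d) ≡ (a ⊕ c) ⊕ (b ⊕ d)
  ⊕-interchange = interchange

  ⊕-left-comm : (a b c : F2 n) → a ⊕ (b ⊕ c) ≡ b ⊕ (a ⊕ c)
  ⊕-left-comm = x∙yz≈y∙xz

  ⊕≡0⇒≡ : (x y : F2 n) → x ⊕ y ≡ zeroV → x ≡ y
  ⊕≡0⇒≡ x y e = sym (inverseʳ-unique x y e)

  ⊕-cancelʳ : (x y : F2 n) → (x ⊕ y) ⊕ y ≡ x
  ⊕-cancelʳ x y = //-rightDividesʳ y x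

  ⊕-cancel-common : (x a b : F2 n) → (x ⊕ a) ⊕ (x ⊕ b) ≡ a ⊕ b
  ⊕-cancel-common x a b = trans (⊕-interchange x a x b) (trans (cong (_⊕ (a ⊕ b)) (⊕-self x)) (⊕-identityˡ (a ⊕ b)))

  ⊕-identityʳ-unique : (x y : F2 n) → x ⊕ y ≡ x → y ≡ zeroV
  ⊕-identityʳ-unique = identityʳ-unique

module _ {n : ℕ} where

  infix 4 _∈⟨_⟩ _∉⟨_⟩ _⊆⟨_⟩ _∈⟨?_⟩

  _∈⟨_⟩ : F2 n → List (F2 n) → Set
  w ∈⟨ [] ⟩    = w ≡ zeroV
  w ∈⟨ x ∷ L ⟩ = w ∈⟨ L ⟩ ⊎ x ⊕ w ∈⟨ L ⟩

  _∉⟨_⟩ : F2 n → List (F2 n) → Set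
  w ∉⟨ L ⟩ = ¬ w ∈⟨ L ⟩

  _⊆⟨_⟩ : List (F2 n) → List (F2 n) → Set
  S ⊆⟨ L ⟩ = All (_∈⟨ L ⟩) S

  _≟_ : (x y : F2 n) → Dec (x ≡ y)
  _≟_ = ≡-dec _≟ᵇ_

  _∈⟨?_⟩ : ∀ w L → Dec (w ∈⟨ L ⟩)
  w ∈⟨? [] ⟩    = w ≟ zeroV
  w ∈⟨? x ∷ L ⟩ = w ∈⟨? L ⟩ ⊎-dec x ⊕ w ∈⟨? L ⟩

  zero∈⟨⟩ : ∀ L → zeroV ∈⟨ L ⟩
  zero∈⟨⟩ []      = refl
  zero∈⟨⟩ (x ∷ L) = inj₁ (zero∈⟨⟩ L)

  ⊕-∈⟨⟩ : ∀ L {a b} → a ∈⟨ L ⟩ → b ∈⟨ L ⟩ → a ⊕ b ∈⟨ L ⟩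
  ⊕-∈⟨⟩ []      refl      refl      = ⊕-self zeroV
  ⊕-∈⟨⟩ (x ∷ L) (inj₁ ha) (inj₁ hb) = inj₁ (⊕-∈⟨⟩ L ha hb)
  ⊕-∈⟨⟩ (x ∷ L) {a} {b} (inj₁ ha) (inj₂ hb) =
    inj₂ (subst (_∈⟨ L ⟩) (⊕-left-comm a x b) (⊕-∈⟨⟩ L ha hb))
  ⊕-∈⟨⟩ (x ∷ L) {a} {b} (inj₂ ha) (inj₁ hb) =
    inj₂ (subst (_∈⟨ L ⟩) (⊕-assoc x a b) (⊕-∈⟨⟩ L ha hb))
  ⊕-∈⟨⟩ (x ∷ L) {a} {b} (inj₂ ha) (inj₂ hb) =
    inj₁ (subst (_∈⟨ L ⟩) (⊕-cancel-common x a b) (⊕-∈⟨⟩ L ha hb))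

  ∈⇒∈⟨⟩ : ∀ {L x} → x ∈ L → x ∈⟨ L ⟩
  ∈⇒∈⟨⟩ {y ∷ L} (here refl) = inj₂ (subst (_∈⟨ L ⟩) (sym (⊕-self y)) (zero∈⟨⟩ L))
  ∈⇒∈⟨⟩ {y ∷ L} (there x∈L) = inj₁ (∈⇒∈⟨⟩ x∈L)

  ∈⟨⟩-mono : ∀ {L L'} → L ⊆⟨ L' ⟩ → ∀ {w} → w ∈⟨ L ⟩ → w ∈⟨ L' ⟩
  ∈⟨⟩-mono {[]}    {L'} []         refl     = zero∈⟨⟩ L'
  ∈⟨⟩-mono {x ∷ L}      (_ ∷ L⊆)   (inj₁ h) = ∈⟨⟩-mono L⊆ h
  ∈⟨⟩-mono {x ∷ L} {L'} (x∈ ∷ L⊆) {w} (inj₂ h) =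
    subst (_∈⟨ L' ⟩) (⊕-cancelˡ x w) (⊕-∈⟨⟩ L' x∈ (∈⟨⟩-mono L⊆ h))

  ⊆⟨⟩-trans : ∀ {A B C} → A ⊆⟨ B ⟩ → B ⊆⟨ C ⟩ → A ⊆⟨ C ⟩
  ⊆⟨⟩-trans A⊆B B⊆C = All.map (∈⟨⟩-mono B⊆C) A⊆B

  ⊆⇒⊆⟨⟩ : ∀ {L L'} → (∀ {x} → x ∈ L → x ∈ L') → L ⊆⟨ L' ⟩
  ⊆⇒⊆⟨⟩ L⊆L' = All.tabulate (λ x∈L → ∈⇒∈⟨⟩ (L⊆L' x∈L))

  ⊆⟨⟩-refl : ∀ L → L ⊆⟨ L ⟩
  ⊆⟨⟩-refl L = ⊆⇒⊆⟨⟩ (λ x∈L → x∈L)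

module _ {n : ℕ} where

  infix 4 _∈Σ_

  _∈Σ_ : F2 n → List (List (F2 n)) → Set
  w ∈Σ []      = w ≡ zeroV
  w ∈Σ (S ∷ F) = ∃ λ s → s ∈ S × s ⊕ w ∈Σ F

  ∈Σ-∷ : ∀ {S F s p} → s ∈ S → p ∈Σ F → s ⊕ p ∈Σ S ∷ F
  ∈Σ-∷ {F = F} {s} {p} s∈S p∈ΣF = s , s∈S , subst (_∈Σ F) (sym (⊕-cancelˡ s p)) p∈ΣF

  ∈Σ-++⁺ : ∀ F G {p q} → p ∈Σ F → q ∈Σ G → p ⊕ q ∈Σ F ++ G
  ∈Σ-++⁺ []      G {q = q} refl q∈ΣG = subst (_∈Σ G) (sym (⊕-identityˡ q)) q∈ΣG
  ∈Σ-++⁺ (S ∷ F) G {p} {q} (s , s∈S , h) q∈ΣG =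
    s , s∈S , subst (_∈Σ F ++ G) (⊕-assoc s p q) (∈Σ-++⁺ F G h q∈ΣG)

  ∈Σ-++⁻ : ∀ F G {w} → w ∈Σ F ++ G → ∃ λ p → p ∈Σ F × p ⊕ w ∈Σ G
  ∈Σ-++⁻ []      G {w} h = zeroV , refl , subst (_∈Σ G) (sym (⊕-identityˡ w)) h
  ∈Σ-++⁻ (S ∷ F) G {w} (s , s∈S , h) with ∈Σ-++⁻ F G h
  ... | p , p∈ΣF , q∈ΣG =
    s ⊕ p , ∈Σ-∷ s∈S p∈ΣF , subst (_∈Σ G) (sym (trans (⊕-assoc s p w) (⊕-left-comm s p w))) q∈ΣG

  ∈Σ-resp-↭ : ∀ {F G} → F ↭ G → ∀ {w} → w ∈Σ F → w ∈Σ G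
  ∈Σ-resp-↭ ↭-refl       h                                = h
  ∈Σ-resp-↭ (prep S F↭G) (s , s∈S , h)                    = s , s∈S , ∈Σ-resp-↭ F↭G h
  ∈Σ-resp-↭ (swap S T F↭G) {w} (s , s∈S , (t , t∈T , h)) =
    t , t∈T , (s , s∈S , ∈Σ-resp-↭ F↭G (subst (_∈Σ _) (⊕-left-comm t s w) h))
  ∈Σ-resp-↭ (↭-trans F↭G G↭H) h                          = ∈Σ-resp-↭ G↭H (∈Σ-resp-↭ F↭G h)

  ∈Σ-⊆⟨⟩ : ∀ {L} F → All (_⊆⟨ L ⟩) F → ∀ {w} → w ∈Σ F → w ∈⟨ L ⟩
  ∈Σ-⊆⟨⟩ {L} []      []          refl = zero∈⟨⟩ L
  ∈Σ-⊆⟨⟩ {L} (S ∷ F) (S⊆ ∷ F⊆) {w} (s , s∈S , h) =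
    subst (_∈⟨ L ⟩) (⊕-cancelˡ s w) (⊕-∈⟨⟩ L (All.lookup S⊆ s∈S) (∈Σ-⊆⟨⟩ F F⊆ h))

  infixl 6 _⊞_

  _⊞_ : List (F2 n) → List (F2 n) → List (F2 n)
  _⊞_ = cartesianProductWith _⊕_

  ⊞⁺ : ∀ {S T s t} → s ∈ S → t ∈ T → s ⊕ t ∈ S ⊞ T
  ⊞⁺ = ∈-cartesianProductWith⁺ _⊕_

  ⊞⁻ : ∀ S T {w} → w ∈ S ⊞ T → ∃ λ s → ∃ λ t → s ∈ S × t ∈ T × w ≡ s ⊕ t
  ⊞⁻ = ∈-cartesianProductWith⁻ _⊕_

  sumset : List (List (F2 n)) → List (F2 n)
  sumset = foldr _⊞_ (zeroV ∷ [])

  ∈Σ⇒∈sumset : ∀ F {w} → w ∈Σ F → w ∈ sumset F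
  ∈Σ⇒∈sumset []      refl              = here refl
  ∈Σ⇒∈sumset (S ∷ F) {w} (s , s∈S , h) = subst (_∈ sumset (S ∷ F)) (⊕-cancelˡ s w) (⊞⁺ s∈S (∈Σ⇒∈sumset F h))

  ∈sumset⇒∈Σ : ∀ F {w} → w ∈ sumset F → w ∈Σ F
  ∈sumset⇒∈Σ []      (here w≡0) = w≡0
  ∈sumset⇒∈Σ (S ∷ F) w∈ with ⊞⁻ S (sumset F) w∈
  ... | s , p , s∈S , p∈ , refl = ∈Σ-∷ s∈S (∈sumset⇒∈Σ F p∈)

  ∈Σ-⊞⁺ : ∀ S T F {w} → w ∈Σ S ∷ T ∷ F → w ∈Σ S ⊞ T ∷ F
  ∈Σ-⊞⁺ S T F {w} (s , s∈S , t , t∈T , h) =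
    s ⊕ t , ⊞⁺ s∈S t∈T , subst (_∈Σ F) (sym (trans (⊕-assoc s t w) (⊕-left-comm s t w))) h

  ∈Σ-⊞⁻ : ∀ S T F {w} → w ∈Σ S ⊞ T ∷ F → w ∈Σ S ∷ T ∷ F
  ∈Σ-⊞⁻ S T F {w} (x , x∈ , h) with ⊞⁻ S T x∈
  ... | s , t , s∈S , t∈T , refl =
    s , s∈S , t , t∈T , subst (_∈Σ F) (trans (⊕-assoc s t w) (⊕-left-comm s t w)) h

  ∈Σ-split : ∀ {F} I R → F ↭ I ++ R → ∀ {w} → w ∈Σ F → ∃ λ p → ∃ λ r → p ∈Σ I × r ∈Σ R × w ≡ p ⊕ r
  ∈Σ-split I R F↭ {w} w∈ with ∈Σ-++⁻ I R (∈Σ-resp-↭ F↭ w∈)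
  ... | p , p∈ , r∈ = p , p ⊕ w , p∈ , r∈ , sym (⊕-cancelˡ p w)

-- Steinitz exchange

module _ {n : ℕ} where

  ↭⇒⊆⟨⟩ : {L L' : List (F2 n)} → L ↭ L' → L ⊆⟨ L' ⟩
  ↭⇒⊆⟨⟩ L↭L' = ⊆⇒⊆⟨⟩ (∈-resp-↭ L↭L')

  exchange-one : ∀ (d : F2 n) b z → d ∈⟨ b ++ z ⟩ → d ∉⟨ z ⟩ →
    ∃ λ b' → suc (length b') ≡ length b × b ++ z ⊆⟨ b' ++ d ∷ z ⟩ × b' ++ d ∷ z ⊆⟨ b ++ z ⟩
  exchange-one d []      z d∈ d∉ = ⊥-elim (d∉ d∈)
  exchange-one d (x ∷ b) z (inj₁ d∈) d∉ with exchange-one d b z d∈ d∉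
  ... | b' , len , ⊆₁ , ⊆₂ =
    x ∷ b' , cong suc len , ∈⇒∈⟨⟩ (here refl) ∷ All.map inj₁ ⊆₁ , ∈⇒∈⟨⟩ (here refl) ∷ All.map inj₁ ⊆₂
  exchange-one d (x ∷ b) z (inj₂ x⊕d∈) d∉ =
    b , refl , x∈ ∷ ⊆⟨⟩-trans (All.map inj₁ (⊆⟨⟩-refl (b ++ z))) d∷b++z⊆ ,
    All-resp-↭ d∷b++z↭ (inj₂ x⊕d∈ ∷ ⊆⇒⊆⟨⟩ there)
    where
    d∷b++z↭ : d ∷ b ++ z ↭ b ++ d ∷ z
    d∷b++z↭ = ↭-sym (shift d b z)
    d∷b++z⊆ : d ∷ b ++ z ⊆⟨ b ++ d ∷ z ⟩
    d∷b++z⊆ = ↭⇒⊆⟨⟩ d∷b++z↭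
    x∈ : x ∈⟨ b ++ d ∷ z ⟩
    x∈ = subst (_∈⟨ b ++ d ∷ z ⟩) (⊕-cancelʳ x d)
           (∈⟨⟩-mono d∷b++z⊆ (⊕-∈⟨⟩ (d ∷ b ++ z) (inj₁ x⊕d∈) (∈⇒∈⟨⟩ (here refl))))

  exchange-all : ∀ (ws b z : List (F2 n)) → ws ⊆⟨ b ++ z ⟩ →
      (∃ λ b' → length b' + length ws ≡ length b × b ++ z ⊆⟨ b' ++ ws ++ z ⟩ × b' ++ ws ++ z ⊆⟨ b ++ z ⟩)
    ⊎ (∃ λ ws' → suc (length ws') ≡ length ws × ws ⊆⟨ ws' ++ z ⟩ × ws' ⊆⟨ b ++ z ⟩)
  exchange-all []       b z [] = inj₁ (b , +-identityʳ (length b) , ⊆⟨⟩-refl (b ++ z) , ⊆⟨⟩-refl (b ++ z))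
  exchange-all (w ∷ ws) b z (w∈ ∷ ws⊆) with exchange-all ws b z ws⊆
  ... | inj₂ (ws' , len , ws⊆' , ws'⊆) =
    inj₂ (w ∷ ws' , cong suc len , ∈⇒∈⟨⟩ (here refl) ∷ All.map inj₁ ws⊆' , w∈ ∷ ws'⊆)
  ... | inj₁ (b₁ , len₁ , ⊆₁ , ⊇₁) with w ∈⟨? ws ++ z ⟩
  ...   | yes w∈' = inj₂ (ws , refl , w∈' ∷ ⊆⇒⊆⟨⟩ ∈-++⁺ˡ , ws⊆)
  ...   | no w∉ with exchange-one w b₁ (ws ++ z) (∈⟨⟩-mono ⊆₁ w∈) w∉
  ...     | b₂ , len₂ , ⊆₂ , ⊇₂ =
    inj₁ (b₂ , trans (+-suc (length b₂) (length ws)) (trans (cong (_+ length ws) len₂) len₁) ,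
          ⊆⟨⟩-trans ⊆₁ ⊆₂ , ⊆⟨⟩-trans ⊇₂ ⊇₁)

-- A Rado-type dichotomy: the sumset covers the span, or some sets are too crowded

select : {A : Set} {P : A → Set} → Decidable P → (xs : List A) →
         (∃₂ λ x xs' → P x × xs ↭ x ∷ xs') ⊎ All (¬_ ∘ P) xs
select P? []       = inj₂ []
select P? (x ∷ xs) with P? x | select P? xs
... | yes px | _                          = inj₁ (x , xs , px , ↭-refl)
... | no ¬px | inj₂ none                  = inj₂ (¬px ∷ none)
... | no ¬px | inj₁ (y , ys , py , xs↭) = inj₁ (y , x ∷ ys , py , ↭-trans (prep x xs↭) (swap x y ↭-refl))

+≤suc⇒≤ʳ : ∀ a b m → a + b ≤ suc m → 1 ≤ a → b ≤ m
+≤suc⇒≤ʳ (suc a) b m (s≤s a+b≤m) _ = m+n≤o⇒n≤o a a+b≤m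

+≤suc⇒≤ˡ : ∀ a b m → a + b ≤ suc m → 1 ≤ b → a ≤ m
+≤suc⇒≤ˡ a b m a+b≤ = +≤suc⇒≤ʳ b a m (subst (_≤ suc m) (+-comm a b) a+b≤)

length-↭++ : {A : Set} {xs : List A} (ys zs : List A) → xs ↭ ys ++ zs → length xs ≡ length ys + length zs
length-↭++ ys zs xs↭ = trans (↭-length xs↭) (length-++ ys)

module _ {n : ℕ} where

  Family : Set
  Family = List (List (F2 n))

  Admissible : (z L S : List (F2 n)) → Set
  Admissible z L S = S ⊆⟨ L ⟩ × zeroV ∈ S × Any (_∉⟨ z ⟩) S

  Covers : (z L : List (F2 n)) → Family → Set
  Covers z L F = ∀ w → w ∈⟨ L ⟩ → ∃ λ p → p ∈Σ F × p ⊕ w ∈⟨ z ⟩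

  record Deficient (z L : List (F2 n)) (F : Family) : Set where
    constructor deficient
    field
      inside outside : Family
      gens           : List (F2 n)
      split          : F ↭ inside ++ outside
      overfull       : suc (length gens) ≡ length inside
      gens⊆          : gens ⊆⟨ L ⟩
      inside⊆        : All (_⊆⟨ gens ++ z ⟩) inside

  infix 4 _⊆⟨?_⟩

  _⊆⟨?_⟩ : ∀ (S L : List (F2 n)) → Dec (S ⊆⟨ L ⟩)
  S ⊆⟨? L ⟩ = All.all? (_∈⟨? L ⟩) S

  ⊈⇒escapes : ∀ {S L : List (F2 n)} → ¬ S ⊆⟨ L ⟩ → Any (_∉⟨ L ⟩) S
  ⊈⇒escapes {S} {L} = ¬All⇒Any¬ (_∈⟨? L ⟩) S

  escapes-anti : ∀ {L L' : List (F2 n)} → L' ⊆⟨ L ⟩ → ∀ {S} → Any (_∉⟨ L ⟩) S → Any (_∉⟨ L' ⟩) S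
  escapes-anti L'⊆L = Any.map (λ x∉L x∈L' → x∉L (∈⟨⟩-mono L'⊆L x∈L'))

  covers-resp-↭ : ∀ {z L F G} → F ↭ G → Covers z L F → Covers z L G
  covers-resp-↭ F↭G cov w w∈ with cov w w∈
  ... | p , p∈ΣF , p⊕w∈ = p , ∈Σ-resp-↭ F↭G p∈ΣF , p⊕w∈

  covers-mono : ∀ {z L L' F} → L' ⊆⟨ L ⟩ → Covers z L F → Covers z L' F
  covers-mono L'⊆L cov w w∈ = cov w (∈⟨⟩-mono L'⊆L w∈)

  covers-∷ : ∀ {z L S F d} → zeroV ∈ S → d ∈ S → Covers (d ∷ z) L F → Covers z L (S ∷ F)
  covers-∷ {S = S} {F} 0∈S d∈S cov w w∈ with cov w w∈
  ... | p , p∈ΣF , inj₁ p⊕w∈ = p , subst (_∈Σ S ∷ F) (⊕-identityˡ p) (∈Σ-∷ 0∈S p∈ΣF) , p⊕w∈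
  ... | p , p∈ΣF , inj₂ d⊕p⊕w∈ = _ , ∈Σ-∷ d∈S p∈ΣF , subst (_∈⟨ _ ⟩) (sym (⊕-assoc _ p w)) d⊕p⊕w∈

  covers-++ : ∀ {z ws L FC FR} → Covers z (ws ++ z) FC → Covers (ws ++ z) L FR → Covers z L (FC ++ FR)
  covers-++ {FC = FC} {FR} covC covR w w∈ with covR w w∈
  ... | p , p∈ΣR , p⊕w∈ with covC (p ⊕ w) p⊕w∈
  ...   | q , q∈ΣC , q⊕p⊕w∈ = q ⊕ p , ∈Σ-++⁺ FC FR q∈ΣC p∈ΣR , subst (_∈⟨ _ ⟩) (sym (⊕-assoc q p w)) q⊕p⊕w∈

  record Pivot (z : List (F2 n)) (F : Family) : Set where
    constructor pivot
    field
      S       : List (F2 n)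
      others  : Family
      d       : F2 n
      split   : F ↭ S ∷ others
      d∈S     : d ∈ S
      d∉      : d ∉⟨ z ⟩
      escapes : All (Any (_∉⟨ d ∷ z ⟩)) others

  -- If two sets other than S lie in ⟨ d ∷ z ⟩ the family is deficient; if exactly one does, it becomes the pivot.
  pivot-or-deficient : ∀ z L S F → All (Admissible z L) (S ∷ F) → Pivot z (S ∷ F) ⊎ Deficient z L (S ∷ F)
  pivot-or-deficient z L S F ((S⊆ , _ , S-escapes) ∷ adm) with find S-escapes
  ... | d , d∈S , d∉ with select (_⊆⟨? d ∷ z ⟩) F
  ...   | inj₂ F⊈ = inj₁ (pivot S F d ↭-refl d∈S d∉ (All.map ⊈⇒escapes F⊈))
  ...   | inj₁ (Sᵢ , F' , Sᵢ⊆ , F↭) with select (_⊆⟨? d ∷ z ⟩) (S ∷ F')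
  ...     | inj₁ (Sⱼ , F'' , Sⱼ⊆ , S∷F'↭) =
    inj₂ (deficient (Sᵢ ∷ Sⱼ ∷ []) F'' (d ∷ []) perm refl (All.lookup S⊆ d∈S ∷ []) (Sᵢ⊆ ∷ Sⱼ⊆ ∷ []))
    where
    perm : S ∷ F ↭ Sᵢ ∷ Sⱼ ∷ F''
    perm = ↭-trans (prep S F↭) (↭-trans (swap S Sᵢ ↭-refl) (prep Sᵢ S∷F'↭))
  ...     | inj₂ S∷F'⊈ with All-resp-↭ F↭ adm
  ...       | (_ , _ , Sᵢ-escapes) ∷ _ with find Sᵢ-escapes
  ...         | d' , d'∈Sᵢ , d'∉ =
    inj₁ (pivot Sᵢ (S ∷ F') d' (↭-trans (prep S F↭) (swap S Sᵢ ↭-refl)) d'∈Sᵢ d'∉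
           (All.map (escapes-anti (All.lookup Sᵢ⊆ d'∈Sᵢ ∷ All.map inj₁ (⊆⟨⟩-refl z)) ∘ ⊈⇒escapes) S∷F'⊈))

  record Block (z L : List (F2 n)) (F : Family) : Set where
    constructor block
    field
      inside outside : Family
      gens           : List (F2 n)
      split          : F ↭ inside ++ outside
      tight          : length gens ≡ length inside
      gens⊆          : gens ⊆⟨ L ⟩
      inside⊆        : All (_⊆⟨ gens ++ z ⟩) inside
      1≤|gens|       : 1 ≤ length gens
      1≤|outside|    : 1 ≤ length outside

  CoverOrDeficient : ℕ → Set
  CoverOrDeficient m = ∀ z b F → length F ≤ m → length F ≡ length b →
    All (Admissible z (b ++ z)) F → Covers z (b ++ z) F ⊎ Deficient z (b ++ z) F

  -- Exchange the pivot vector d into the generators and recurse modulo ⟨ d ∷ z ⟩.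
  pivot-step : ∀ {m} → CoverOrDeficient m → ∀ z b F → length F ≤ suc m → length F ≡ length b →
    All (Admissible z (b ++ z)) F → Pivot z F → Covers z (b ++ z) F ⊎ Block z (b ++ z) F
  pivot-step {m} IH z b F |F|≤ |F|≡ adm (pivot S others d F↭ d∈S d∉ escapes)
    with All-resp-↭ F↭ adm
  ... | (S⊆ , 0∈S , _) ∷ adm' with exchange-one d b z (All.lookup S⊆ d∈S) d∉
  ...   | b' , |b'|+1≡ , ⊆₁ , ⊇₁
    with IH (d ∷ z) b' others |others|≤ |others|≡
            (All.zipWith (λ ((S'⊆ , 0∈S' , _) , esc) → ⊆⟨⟩-trans S'⊆ ⊆₁ , 0∈S' , esc) (adm' , escapes))
    where
    |others|≤ : length others ≤ m
    |others|≤ = ≤-pred (subst (_≤ suc m) (↭-length F↭) |F|≤)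
    |others|≡ : length others ≡ length b'
    |others|≡ = suc-injective (trans (sym (↭-length F↭)) (trans |F|≡ (sym |b'|+1≡)))
  ... | inj₁ cov = inj₁ (covers-resp-↭ (↭-sym F↭) (covers-∷ 0∈S d∈S (covers-mono ⊆₁ cov)))
  ... | inj₂ (deficient FC FR y others↭ overfull y⊆ FC⊆) =
    inj₂ (block FC (S ∷ FR) (d ∷ y) perm overfull (All.lookup S⊆ d∈S ∷ ⊆⟨⟩-trans y⊆ ⊇₁)
           (All.map (λ S'⊆ → ⊆⟨⟩-trans S'⊆ (↭⇒⊆⟨⟩ (shift d y z))) FC⊆) (s≤s z≤n) (s≤s z≤n))
    where
    perm : F ↭ FC ++ S ∷ FR
    perm = ↭-trans F↭ (↭-trans (prep S others↭) (↭-sym (shift S FC FR)))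

  module CloseBlock {m} (IH : CoverOrDeficient m) (z b : List (F2 n)) {F : Family}
                    (|F|≤ : length F ≤ suc m) (|F|≡ : length F ≡ length b)
                    (adm : All (Admissible z (b ++ z)) F) (blk : Block z (b ++ z) F) where
    open Block blk

    |F|≡|in|+|out| : length F ≡ length inside + length outside
    |F|≡|in|+|out| = length-↭++ inside outside split

    adm-in : All (Admissible z (b ++ z)) inside
    adm-in = proj₁ (++⁻ inside (All-resp-↭ split adm))

    adm-out : All (Admissible z (b ++ z)) outside
    adm-out = proj₂ (++⁻ inside (All-resp-↭ split adm))

    inside-step : Covers z (gens ++ z) inside ⊎ Deficient z (b ++ z) F
    inside-step with IH z gens inside |in|≤ (sym tight)
                       (All.zipWith (λ ((_ , 0∈S , esc) , S⊆) → S⊆ , 0∈S , esc) (adm-in , inside⊆))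
      where
      |in|≤ : length inside ≤ m
      |in|≤ = +≤suc⇒≤ˡ (length inside) (length outside) m (subst (_≤ suc m) |F|≡|in|+|out| |F|≤) 1≤|outside|
    ... | inj₁ cov = inj₁ cov
    ... | inj₂ (deficient C₁ C₂ y C↭ overfull y⊆ C₁⊆) =
      inj₂ (deficient C₁ (C₂ ++ outside) y perm overfull (⊆⟨⟩-trans y⊆ (++⁺ gens⊆ (⊆⇒⊆⟨⟩ (∈-++⁺ʳ b)))) C₁⊆)
      where
      perm : F ↭ C₁ ++ C₂ ++ outside
      perm = ↭-trans split (↭-trans (++⁺ʳ outside C↭) (↭.++-assoc C₁ C₂ outside))

    outside-step : ∀ b' → length b' + length gens ≡ length b →
      b ++ z ⊆⟨ b' ++ gens ++ z ⟩ → b' ++ gens ++ z ⊆⟨ b ++ z ⟩ →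
      Covers z (gens ++ z) inside → Covers z (b ++ z) F ⊎ Deficient z (b ++ z) F
    outside-step b' |b'|+|gens|≡ ⊆₁ ⊇₁ cov-in with select (_⊆⟨? gens ++ z ⟩) outside
    ... | inj₁ (S , out , S⊆ , outside↭) =
      inj₂ (deficient (S ∷ inside) out gens (↭-trans split (↭-trans (++⁺ˡ inside outside↭) (shift S inside out)))
                      (cong suc tight) gens⊆ (S⊆ ∷ inside⊆))
    ... | inj₂ outside⊈
      with IH (gens ++ z) b' outside |out|≤ |out|≡
              (All.zipWith (λ ((S⊆ , 0∈S , _) , S⊈) → ⊆⟨⟩-trans S⊆ ⊆₁ , 0∈S , ⊈⇒escapes S⊈) (adm-out , outside⊈))
      where
      |out|≤ : length outside ≤ m
      |out|≤ = +≤suc⇒≤ʳ (length inside) (length outside) m (subst (_≤ suc m) |F|≡|in|+|out| |F|≤)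
                 (subst (1 ≤_) tight 1≤|gens|)
      |out|≡ : length outside ≡ length b'
      |out|≡ = sym (+-cancelʳ-≡ (length gens) (length b') (length outside) (begin
        length b' + length gens       ≡⟨ |b'|+|gens|≡ ⟩
        length b                      ≡⟨ sym |F|≡ ⟩
        length F                      ≡⟨ |F|≡|in|+|out| ⟩
        length inside + length outside ≡⟨ cong (_+ length outside) (sym tight) ⟩
        length gens + length outside  ≡⟨ +-comm (length gens) (length outside) ⟩
        length outside + length gens  ∎))
        where open ≡-Reasoning
    ... | inj₁ cov-out = inj₁ (covers-resp-↭ (↭-sym split) (covers-++ cov-in (covers-mono ⊆₁ cov-out)))
    ... | inj₂ (deficient D₁ D₂ y D↭ overfull y⊆ D₁⊆) =
      inj₂ (deficient (D₁ ++ inside) D₂ (y ++ gens) perm |y++gens|+1≡ (++⁺ (⊆⟨⟩-trans y⊆ ⊇₁) gens⊆)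
             (subst (λ L → All (_⊆⟨ L ⟩) (D₁ ++ inside)) (sym (++-assoc y gens z))
               (++⁺ D₁⊆ (All.map (λ S⊆ → ⊆⟨⟩-trans S⊆ (⊆⇒⊆⟨⟩ (∈-++⁺ʳ y))) inside⊆))))
      where
      perm : F ↭ (D₁ ++ inside) ++ D₂
      perm = begin
        F                       ↭⟨ split ⟩
        inside ++ outside       ↭⟨ ++⁺ˡ inside D↭ ⟩
        inside ++ D₁ ++ D₂      ↭⟨ ↭-sym (↭.++-assoc inside D₁ D₂) ⟩
        (inside ++ D₁) ++ D₂    ↭⟨ ++⁺ʳ D₂ (↭.++-comm inside D₁) ⟩
        (D₁ ++ inside) ++ D₂    ∎
        where open PermutationReasoning
      |y++gens|+1≡ : suc (length (y ++ gens)) ≡ length (D₁ ++ inside)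
      |y++gens|+1≡ = trans (cong suc (length-++ y)) (trans (cong₂ _+_ overfull tight) (sym (length-++ D₁)))

    -- The block covers its own span modulo ⟨ z ⟩; exchanging its generators into b, the rest of the family
    -- is handled modulo that span.
    close-block : Covers z (b ++ z) F ⊎ Deficient z (b ++ z) F
    close-block with inside-step
    ... | inj₂ def = inj₂ def
    ... | inj₁ cov-in with exchange-all gens b z gens⊆
    ...   | inj₁ (b' , |b'|+|gens|≡ , ⊆₁ , ⊇₁) = outside-step b' |b'|+|gens|≡ ⊆₁ ⊇₁ cov-in
    ...   | inj₂ (gens' , |gens'|+1≡ , gens⊆gens'++z , gens'⊆) =
      inj₂ (deficient inside outside gens' split (trans |gens'|+1≡ tight) gens'⊆
             (All.map (λ S⊆ → ⊆⟨⟩-trans S⊆ (++⁺ gens⊆gens'++z (⊆⇒⊆⟨⟩ (∈-++⁺ʳ gens')))) inside⊆))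

  covers-[] : ∀ z → Covers z z []
  covers-[] z w w∈ = zeroV , refl , subst (_∈⟨ z ⟩) (sym (⊕-identityˡ w)) w∈

  cover-or-deficient : ∀ m → CoverOrDeficient m
  cover-or-deficient zero    z b       (S ∷ F) () _    _
  cover-or-deficient _       z []      []      _  _    _     = inj₁ (covers-[] z)
  cover-or-deficient _       z (_ ∷ _) []      _  ()   _
  cover-or-deficient (suc m) z b       (S ∷ F) |F|≤ |F|≡ adm
    with pivot-or-deficient z (b ++ z) S F adm
  ... | inj₂ def = inj₂ def
  ... | inj₁ piv with pivot-step (cover-or-deficient m) z b (S ∷ F) |F|≤ |F|≡ adm piv
  ...   | inj₁ cov = inj₁ cov
  ...   | inj₂ blk = CloseBlock.close-block (cover-or-deficient m) z b |F|≤ |F|≡ adm blk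

-- Sumsets missing exactly one point of a span

module _ {n : ℕ} where

  PuncturedSpan : F2 n → List (F2 n) → Family → Set
  PuncturedSpan u b F = (∀ w → w ∈⟨ b ⟩ → w ≢ u → w ∈Σ F) × ¬ u ∈Σ F

  ⊕-swap-sides : (a b c d : F2 n) → a ⊕ b ≡ c ⊕ d → b ⊕ c ≡ a ⊕ d
  ⊕-swap-sides a b c d e = begin
    b ⊕ c              ≡⟨ sym (⊕-cancelˡ a (b ⊕ c)) ⟩
    a ⊕ (a ⊕ (b ⊕ c))  ≡⟨ cong (a ⊕_) (sym (⊕-assoc a b c)) ⟩
    a ⊕ ((a ⊕ b) ⊕ c)  ≡⟨ cong (λ x → a ⊕ (x ⊕ c)) e ⟩
    a ⊕ ((c ⊕ d) ⊕ c)  ≡⟨ cong (a ⊕_) (trans (⊕-comm (c ⊕ d) c) (⊕-cancelˡ c d)) ⟩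
    a ⊕ d              ∎
    where open ≡-Reasoning

  ⊞-admissible : ∀ {z L S T : List (F2 n)} → Admissible z L S → T ⊆⟨ L ⟩ → zeroV ∈ T → Admissible z L (S ⊞ T)
  ⊞-admissible {z} {L} {S} {T} (S⊆ , 0∈S , S-escapes) T⊆ 0∈T with find S-escapes
  ... | e , e∈S , e∉ =
    All.tabulate sum∈ , subst (_∈ S ⊞ T) (⊕-self zeroV) (⊞⁺ 0∈S 0∈T) ,
    lose (⊞⁺ e∈S 0∈T) (subst (_∉⟨ z ⟩) (sym (⊕-identityʳ e)) e∉)
    where
    sum∈ : ∀ {x} → x ∈ S ⊞ T → x ∈⟨ L ⟩
    sum∈ x∈ with ⊞⁻ S T x∈
    ... | s , t , s∈S , t∈T , refl = ⊕-∈⟨⟩ L (All.lookup S⊆ s∈S) (All.lookup T⊆ t∈T)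

  module Restrict {b : List (F2 n)} {F u} (adm : All (Admissible [] b) F) (u∈ : u ∈⟨ b ⟩)
                  (cover : ∀ w → w ∈⟨ b ⟩ → w ≢ u → w ∈Σ F) (avoid : ¬ u ∈Σ F)
                  {C : List (F2 n)} {G R : Family} {y : List (F2 n)} (F↭ : F ↭ (C ∷ G) ++ R)
                  (y⊆ : y ⊆⟨ b ⟩) (I⊆y++[] : All (_⊆⟨ y ++ [] ⟩) (C ∷ G)) where

    I : Family
    I = C ∷ G

    I⊆y : All (_⊆⟨ y ⟩) I
    I⊆y = subst (λ L → All (_⊆⟨ L ⟩) I) (++-identityʳ y) I⊆y++[]

    ΣI⊆y : ∀ {p} → p ∈Σ I → p ∈⟨ y ⟩
    ΣI⊆y = ∈Σ-⊆⟨⟩ I I⊆y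

    adm-I : All (Admissible [] b) I
    adm-I = proj₁ (++⁻ I (All-resp-↭ F↭ adm))

    adm-R : All (Admissible [] b) R
    adm-R = proj₂ (++⁻ I (All-resp-↭ F↭ adm))

    -- Write u ⊕ e = p₀ ⊕ r₀ with e ∈ C nonzero; then r₀ ⊕ u = p₀ ⊕ e ∈ ⟨ y ⟩.
    anchor : ∃ λ r₀ → r₀ ∈Σ R × r₀ ⊕ u ∈⟨ y ⟩
    anchor with All.head adm-I
    ... | C⊆b , _ , C-escapes with find C-escapes
    ... | e , e∈C , e≢0
      with ∈Σ-split I R F↭ (cover (u ⊕ e) (⊕-∈⟨⟩ b u∈ (All.lookup C⊆b e∈C)) (e≢0 ∘ ⊕-identityʳ-unique u e))
    ... | p₀ , r₀ , p₀∈ΣI , r₀∈ΣR , u⊕e≡p₀⊕r₀ =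
      r₀ , r₀∈ΣR , subst (_∈⟨ y ⟩) (sym (⊕-swap-sides p₀ r₀ u e (sym u⊕e≡p₀⊕r₀)))
                     (⊕-∈⟨⟩ y (ΣI⊆y p₀∈ΣI) (All.lookup (All.head I⊆y) e∈C))

    -- The sums r of R that can still complete a point of the coset u ⊕ ⟨ y ⟩, translated into ⟨ y ⟩ by r₀.
    module Folded (r₀ : F2 n) (r₀∈ΣR : r₀ ∈Σ R) where

      R' : List (F2 n)
      R' = filter (_∈⟨? y ⟩) (map (r₀ ⊕_) (sumset R))

      R'-intro : ∀ {r} → r ∈Σ R → r₀ ⊕ r ∈⟨ y ⟩ → r₀ ⊕ r ∈ R'
      R'-intro r∈ = ∈-filter⁺ (_∈⟨? y ⟩) (∈-map⁺ (r₀ ⊕_) (∈Σ⇒∈sumset R r∈))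

      R'-elim : ∀ {x} → x ∈ R' → ∃ λ r → r ∈Σ R × x ≡ r₀ ⊕ r
      R'-elim x∈ with ∈-map⁻ (r₀ ⊕_) (proj₁ (∈-filter⁻ (_∈⟨? y ⟩) {xs = map (r₀ ⊕_) (sumset R)} x∈))
      ... | r , r∈ , x≡ = r , ∈sumset⇒∈Σ R r∈ , x≡

      R'⊆y : R' ⊆⟨ y ⟩
      R'⊆y = All.tabulate (λ x∈ → proj₂ (∈-filter⁻ (_∈⟨? y ⟩) {xs = map (r₀ ⊕_) (sumset R)} x∈))

      0∈R' : zeroV ∈ R'
      0∈R' = subst (_∈ R') (⊕-self r₀) (R'-intro r₀∈ΣR (subst (_∈⟨ y ⟩) (sym (⊕-self r₀)) (zero∈⟨⟩ y)))

      folded-admissible : All (Admissible [] y) (C ⊞ R' ∷ G)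
      folded-admissible with adm-I
      ... | (_ , 0∈C , C-escapes) ∷ adm-G =
        ⊞-admissible (All.head I⊆y , 0∈C , C-escapes) R'⊆y 0∈R' ∷
        All.zipWith (λ ((_ , 0∈S , esc) , S⊆y) → S⊆y , 0∈S , esc) (adm-G , All.tail I⊆y)

      folded-cover : ∀ w → w ∈⟨ y ⟩ → w ≢ r₀ ⊕ u → w ∈Σ C ⊞ R' ∷ G
      folded-cover w w∈ w≢ with ∈Σ-split I R F↭ (cover (r₀ ⊕ w) (⊕-∈⟨⟩ b r₀∈b (∈⟨⟩-mono y⊆ w∈)) r₀⊕w≢u)
        where
        r₀∈b : r₀ ∈⟨ b ⟩
        r₀∈b = ∈Σ-⊆⟨⟩ R (All.map proj₁ adm-R) r₀∈ΣR
        r₀⊕w≢u : r₀ ⊕ w ≢ u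
        r₀⊕w≢u r₀⊕w≡u = w≢ (trans (sym (⊕-cancelˡ r₀ w)) (cong (r₀ ⊕_) r₀⊕w≡u))
      ... | p , r , p∈ΣI , r∈ΣR , r₀⊕w≡p⊕r =
        ∈Σ-⊞⁺ C R' G (∈Σ-resp-↭ (swap R' C ↭-refl)
          (subst (_∈Σ R' ∷ I) (trans (cong (_⊕ p) (sym w⊕p≡r₀⊕r)) (⊕-cancelʳ w p))
            (∈Σ-∷ (R'-intro r∈ΣR (subst (_∈⟨ y ⟩) w⊕p≡r₀⊕r (⊕-∈⟨⟩ y w∈ (ΣI⊆y p∈ΣI)))) p∈ΣI)))
        where
        w⊕p≡r₀⊕r : w ⊕ p ≡ r₀ ⊕ r
        w⊕p≡r₀⊕r = ⊕-swap-sides r₀ w p r r₀⊕w≡p⊕r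

      folded-avoid : ¬ r₀ ⊕ u ∈Σ C ⊞ R' ∷ G
      folded-avoid u'∈Σ with ∈Σ-resp-↭ (swap C R' ↭-refl) (∈Σ-⊞⁻ C R' G u'∈Σ)
      ... | x , x∈R' , x⊕u'∈ΣI with R'-elim x∈R'
      ... | r , r∈ΣR , refl = avoid (∈Σ-resp-↭ (↭-sym F↭) (subst (_∈Σ I ++ R) eq (∈Σ-++⁺ I R x⊕u'∈ΣI r∈ΣR)))
        where
        eq : ((r₀ ⊕ r) ⊕ (r₀ ⊕ u)) ⊕ r ≡ u
        eq = begin
          ((r₀ ⊕ r) ⊕ (r₀ ⊕ u)) ⊕ r  ≡⟨ cong (_⊕ r) (⊕-cancel-common r₀ r u) ⟩
          (r ⊕ u) ⊕ r                ≡⟨ ⊕-comm (r ⊕ u) r ⟩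
          r ⊕ (r ⊕ u)                ≡⟨ ⊕-cancelˡ r u ⟩
          u                          ∎
          where open ≡-Reasoning

  restrict-to-deficient : ∀ {b F u} → All (Admissible [] b) F → u ∈⟨ b ⟩ → PuncturedSpan u b F → Deficient [] b F →
    ∃₂ λ y F' → ∃ λ u' → length y < length F × length y ≤ length F' ×
                         All (Admissible [] y) F' × u' ∈⟨ y ⟩ × PuncturedSpan u' y F'
  restrict-to-deficient _ _ _ (deficient [] _ _ _ () _ _)
  restrict-to-deficient {F = F} {u} adm u∈ (cover , avoid) (deficient (C ∷ G) R y F↭ overfull y⊆ I⊆y)
    with Restrict.anchor adm u∈ cover avoid F↭ y⊆ I⊆y
  ... | r₀ , r₀∈ΣR , u'∈ =
    y , C ⊞ R' ∷ G , r₀ ⊕ u , |y|<|F| , ≤-trans (n≤1+n (length y)) (≤-reflexive overfull) ,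
    folded-admissible , u'∈ , folded-cover , folded-avoid
    where
    open Restrict adm u∈ cover avoid F↭ y⊆ I⊆y
    open Folded r₀ r₀∈ΣR
    |y|<|F| : length y < length F
    |y|<|F| = subst (length y <_) (sym (length-↭++ I R F↭)) (≤-trans (≤-reflexive overfull) (m≤m+n (length I) (length R)))

  infix 4 _≈Σ_

  _≈Σ_ : Family → Family → Set
  F ≈Σ G = ∀ {w : F2 n} → w ∈Σ F ⇔ w ∈Σ G

  ∷-≈Σ : ∀ (S : List (F2 n)) {F G} → F ≈Σ G → S ∷ F ≈Σ S ∷ G
  ∷-≈Σ S F≈G = mk⇔ (λ (s , s∈S , h) → s , s∈S , Equivalence.to F≈G h)
                   (λ (s , s∈S , h) → s , s∈S , Equivalence.from F≈G h)

  punctured-resp-≈Σ : ∀ {u : F2 n} {b F G} → F ≈Σ G → PuncturedSpan u b F → PuncturedSpan u b G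
  punctured-resp-≈Σ F≈G (cover , avoid) = (λ w w∈ w≢ → Equivalence.to F≈G (cover w w∈ w≢)) , avoid ∘ Equivalence.from F≈G

  merge-to-length : ∀ {z L : List (F2 n)} k (F : Family) → suc k ≤ length F → All (Admissible z L) F →
    ∃ λ F' → length F' ≡ suc k × All (Admissible z L) F' × F ≈Σ F'
  merge-to-length k (S ∷ F) (s≤s k≤|F|) (admS ∷ adm) with m≤n⇒m<n∨m≡n k≤|F|
  ... | inj₂ refl = S ∷ F , refl , admS ∷ adm , mk⇔ (λ h → h) (λ h → h)
  ... | inj₁ k<|F| with merge-to-length k F k<|F| adm
  ...   | T ∷ F' , |F'|≡ , (T⊆ , 0∈T , _) ∷ adm' , F≈ =
    S ⊞ T ∷ F' , |F'|≡ , ⊞-admissible admS T⊆ 0∈T ∷ adm' ,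
    mk⇔ (∈Σ-⊞⁺ S T F' ∘ Equivalence.to (∷-≈Σ S F≈)) (Equivalence.from (∷-≈Σ S F≈) ∘ ∈Σ-⊞⁻ S T F')

  cover-or-deficient-[] : ∀ (b : List (F2 n)) F → length F ≡ length b → All (Admissible [] b) F → Covers [] b F ⊎ Deficient [] b F
  cover-or-deficient-[] b F |F|≡ adm =
    subst (λ L → Covers [] L F ⊎ Deficient [] L F) (++-identityʳ b)
      (cover-or-deficient (length F) [] b F ≤-refl |F|≡ (subst (λ L → All (Admissible [] L) F) (sym (++-identityʳ b)) adm))

  ¬punctured-span : ∀ f (b : List (F2 n)) F u → length b ≤ f → length b ≤ length F → All (Admissible [] b) F → u ∈⟨ b ⟩ →
    ¬ PuncturedSpan u b F
  ¬punctured-span _ [] [] u _ _ _ u≡0 (_ , avoid) = avoid u≡0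
  ¬punctured-span _ [] (S ∷ F) u _ _ ((S⊆ , _ , S-escapes) ∷ _) _ _ with find S-escapes
  ... | x , x∈S , x≢0 = x≢0 (All.lookup S⊆ x∈S)
  ¬punctured-span zero (_ ∷ _) _ _ () _ _ _ _
  ¬punctured-span (suc f) b@(_ ∷ bs) F u |b|≤ |b|≤|F| adm u∈ punctured
    with merge-to-length (length bs) F |b|≤|F| adm
  ... | F' , |F'|≡ , adm' , F≈ = [ covered , deficient-case ]′ (cover-or-deficient-[] b F' |F'|≡ adm')
    where
    punctured' : PuncturedSpan u b F'
    punctured' = punctured-resp-≈Σ F≈ punctured
    covered : Covers [] b F' → ⊥
    covered cov with cov u u∈
    ... | p , p∈ΣF' , p⊕u≡0 = proj₂ punctured' (subst (_∈Σ F') (⊕≡0⇒≡ p u p⊕u≡0) p∈ΣF')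
    deficient-case : Deficient [] b F' → ⊥
    deficient-case def with restrict-to-deficient adm' u∈ punctured' def
    ... | y , F'' , u' , |y|<|F'| , |y|≤|F''| , adm'' , u'∈ , punctured'' =
      ¬punctured-span f y F'' u' (≤-pred (≤-trans |y|<|F'| (≤-trans (≤-reflexive |F'|≡) |b|≤)))
        |y|≤|F''| adm'' u'∈ punctured''

-- Part (a)

allVectors : ∀ n → List (F2 n)
allVectors zero    = [] ∷ []
allVectors (suc n) = cartesianProductWith _∷_ (true ∷ false ∷ []) (allVectors n)

∈-allVectors : ∀ {n} (w : F2 n) → w ∈ allVectors n
∈-allVectors []      = here refl
∈-allVectors (b ∷ w) = ∈-cartesianProductWith⁺ _∷_ (∈-bools b) (∈-allVectors w)
  where
  ∈-bools : ∀ b → b ∈ true ∷ false ∷ []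
  ∈-bools true  = here refl
  ∈-bools false = there (here refl)

unitVectors : ∀ n → List (F2 n)
unitVectors zero    = []
unitVectors (suc n) = (true ∷ zeroV) ∷ map (false ∷_) (unitVectors n)

length-unitVectors : ∀ n → length (unitVectors n) ≡ n
length-unitVectors zero    = refl
length-unitVectors (suc n) = cong suc (trans (length-map (false ∷_) (unitVectors n)) (length-unitVectors n))

false∷-∈⟨⟩ : ∀ {n} (L : List (F2 n)) {w} → w ∈⟨ L ⟩ → false ∷ w ∈⟨ map (false ∷_) L ⟩
false∷-∈⟨⟩ []      refl     = refl
false∷-∈⟨⟩ (x ∷ L) (inj₁ h) = inj₁ (false∷-∈⟨⟩ L h)
false∷-∈⟨⟩ (x ∷ L) (inj₂ h) = inj₂ (false∷-∈⟨⟩ L h)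

∈⟨unitVectors⟩ : ∀ {n} (w : F2 n) → w ∈⟨ unitVectors n ⟩
∈⟨unitVectors⟩ []                 = refl
∈⟨unitVectors⟩ (false ∷ w)        = inj₁ (false∷-∈⟨⟩ _ (∈⟨unitVectors⟩ w))
∈⟨unitVectors⟩ {suc n} (true ∷ w) =
  inj₂ (subst (_∈⟨ map (false ∷_) (unitVectors n) ⟩) (cong (false ∷_) (sym (⊕-identityˡ w)))
              (false∷-∈⟨⟩ _ (∈⟨unitVectors⟩ w)))

module _ {n : ℕ} where

  vsum-⊕ : ∀ t (f g : Fin t → F2 n) → vsum t (λ i → f i ⊕ g i) ≡ vsum t f ⊕ vsum t g
  vsum-⊕ zero    f g = sym (⊕-self zeroV)
  vsum-⊕ (suc t) f g = trans (cong ((f zero ⊕ g zero) ⊕_) (vsum-⊕ t (f ∘ suc) (g ∘ suc)))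
                             (⊕-interchange (f zero) (g zero) (vsum t (f ∘ suc)) (vsum t (g ∘ suc)))

  ∈Σ-tabulate⁺ : ∀ t (L : Fin t → List (F2 n)) (s : Fin t → F2 n) → (∀ i → s i ∈ L i) →
    vsum t s ∈Σ tabulate L
  ∈Σ-tabulate⁺ zero    L s s∈ = refl
  ∈Σ-tabulate⁺ (suc t) L s s∈ = ∈Σ-∷ (s∈ zero) (∈Σ-tabulate⁺ t (L ∘ suc) (s ∘ suc) (s∈ ∘ suc))

  ∈Σ-tabulate⁻ : ∀ t (L : Fin t → List (F2 n)) {w} → w ∈Σ tabulate L →
    ∃ λ s → (∀ i → s i ∈ L i) × vsum t s ≡ w
  ∈Σ-tabulate⁻ zero    L refl = (λ ()) , (λ ()) , refl
  ∈Σ-tabulate⁻ (suc t) L {w} (x , x∈ , h) with ∈Σ-tabulate⁻ t (L ∘ suc) h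
  ... | s , s∈ , vsum≡ = x Vector.∷ s , cons-∈ , trans (cong (x ⊕_) vsum≡) (⊕-cancelˡ x w)
    where
    cons-∈ : ∀ i → (x Vector.∷ s) i ∈ L i
    cons-∈ zero    = x∈
    cons-∈ (suc i) = s∈ i

  translated : ∀ t → (Fin t → F2 n) → (Fin t → Subset n) → Fin t → Subset n
  translated t x S i w = S i (x i ⊕ w)

  Sumset-translated⁺ : ∀ t x S {w} → Sumset t (translated t x S) w → Sumset t S (vsum t x ⊕ w)
  Sumset-translated⁺ t x S (s , s∈ , refl) = (λ i → x i ⊕ s i) , s∈ , vsum-⊕ t x s

  Sumset-translated⁻ : ∀ t x S {w} → Sumset t S (vsum t x ⊕ w) → Sumset t (translated t x S) w
  Sumset-translated⁻ t x S {w} (s , s∈ , vsum≡) =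
    (λ i → x i ⊕ s i) , (λ i → subst (S i) (sym (⊕-cancelˡ (x i) (s i))) (s∈ i)) ,
    trans (vsum-⊕ t x s) (trans (cong (vsum t x ⊕_) vsum≡) (⊕-cancelˡ (vsum t x) w))

  module _ {t} (T : Fin t → Subset n) (v : F2 n) (represent : ∀ w → w ≢ v → Sumset t T w) where

    representations : List (F2 n) → List (Fin t → F2 n)
    representations []       = []
    representations (w ∷ ws) with w ≟ v
    ... | yes _   = representations ws
    ... | no w≢v  = proj₁ (represent w w≢v) ∷ representations ws

    representations-sound : ∀ ws → All (λ s → ∀ i → T i (s i)) (representations ws)
    representations-sound []       = []
    representations-sound (w ∷ ws) with w ≟ v
    ... | yes _   = representations-sound ws
    ... | no w≢v  = proj₁ (proj₂ (represent w w≢v)) ∷ representations-sound ws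

    representations-complete : ∀ ws {w} → w ∈ ws → w ≢ v → ∃ λ s → s ∈ representations ws × vsum t s ≡ w
    representations-complete (w ∷ ws) (here refl) w≢v with w ≟ v
    ... | yes w≡v  = ⊥-elim (w≢v w≡v)
    ... | no w≢v'  = proj₁ (represent w w≢v') , here refl , proj₂ (proj₂ (represent w w≢v'))
    representations-complete (w' ∷ ws) (there w∈) w≢v with w' ≟ v | representations-complete ws w∈ w≢v
    ... | yes _ | s , s∈ , vsum≡ = s , s∈ , vsum≡
    ... | no _  | s , s∈ , vsum≡ = s , there s∈ , vsum≡

  -- Each set is replaced by a finite subset: 0, a nonzero element, and the i-th summands of chosen
  -- representations of all points other than v; these lists still sum to everything except v.
  ¬punctured-space : ∀ t (T : Fin t → Subset n) v → n ≤ t → (∀ i → T i zeroV) →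
    (∀ i → ∃ λ e → e ≢ zeroV × T i e) → (∀ w → w ≢ v → Sumset t T w) → ¬ ¬ Sumset t T v
  ¬punctured-space t T v n≤t T∋0 T∋e represent v∉ =
    ¬punctured-span n (unitVectors n) (tabulate L) v (≤-reflexive (length-unitVectors n))
      (subst₂ _≤_ (sym (length-unitVectors n)) (sym (length-tabulate L)) n≤t)
      (tabulate⁺ admissible) (∈⟨unitVectors⟩ v) (cover , avoid)
    where
    R : List (Fin t → F2 n)
    R = representations T v represent (allVectors n)
    L : Fin t → List (F2 n)
    L i = zeroV ∷ proj₁ (T∋e i) ∷ map (λ s → s i) R
    admissible : ∀ i → Admissible [] (unitVectors n) (L i)
    admissible i = All.tabulate (λ {w} _ → ∈⟨unitVectors⟩ w) , here refl , lose (there (here refl)) (proj₁ (proj₂ (T∋e i)))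
    L⊆T : ∀ i → All (T i) (L i)
    L⊆T i = T∋0 i ∷ proj₂ (proj₂ (T∋e i)) ∷
            map⁺ (All.map (λ s∈T → s∈T i) (representations-sound T v represent (allVectors n)))
    cover : ∀ w → w ∈⟨ unitVectors n ⟩ → w ≢ v → w ∈Σ tabulate L
    cover w _ w≢v with representations-complete T v represent (allVectors n) (∈-allVectors w) w≢v
    ... | s , s∈R , refl = ∈Σ-tabulate⁺ t L s (λ i → there (there (∈-map⁺ (λ s → s i) s∈R)))
    avoid : ¬ v ∈Σ tabulate L
    avoid v∈Σ with ∈Σ-tabulate⁻ t L v∈Σ
    ... | s , s∈L , vsum≡ = v∉ (s , (λ i → All.lookup (L⊆T i) (s∈L i)) , vsum≡)

partA : ∀ n t (S : Fin t → Subset n) → (∀ i → AtLeastTwo (S i)) →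
  ∃ (λ v → Sumset t S ≐ AllBut v) → t ≤ n ∸ 1
partA n t S two (v , S≐) with t ≤? n ∸ 1
... | yes t≤ = t≤
... | no t≰ =
  ⊥-elim (¬punctured-space t T (a ⊕ v) n≤t T∋0 T∋e represent
    (λ T∋a⊕v → proj₁ (S≐ v) (subst (Sumset t S) (⊕-cancelˡ a v) (Sumset-translated⁺ t x S T∋a⊕v)) refl))
  where
  x y : Fin t → F2 n
  x i = proj₁ (two i)
  y i = proj₁ (proj₂ (two i))
  x∈S : ∀ i → S i (x i)
  x∈S i = proj₁ (proj₂ (proj₂ (two i)))
  y∈S : ∀ i → S i (y i)
  y∈S i = proj₁ (proj₂ (proj₂ (proj₂ (two i))))
  x≢y : ∀ i → x i ≢ y i
  x≢y i = proj₂ (proj₂ (proj₂ (proj₂ (two i))))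
  a : F2 n
  a = vsum t x
  T : Fin t → Subset n
  T = translated t x S
  n≤t : n ≤ t
  n≤t = ≤-trans (m≤n+m∸n n 1) (≰⇒> t≰)
  T∋0 : ∀ i → T i zeroV
  T∋0 i = subst (S i) (sym (⊕-identityʳ (x i))) (x∈S i)
  T∋e : ∀ i → ∃ λ e → e ≢ zeroV × T i e
  T∋e i = x i ⊕ y i , x≢y i ∘ ⊕≡0⇒≡ (x i) (y i) , subst (S i) (sym (⊕-cancelˡ (x i) (y i))) (y∈S i)
  represent : ∀ w → w ≢ a ⊕ v → Sumset t T w
  represent w w≢ = Sumset-translated⁻ t x S (proj₂ (S≐ (a ⊕ w)) a⊕w≢v)
    where
    a⊕w≢v : a ⊕ w ≢ v
    a⊕w≢v a⊕w≡v = w≢ (trans (sym (⊕-cancelˡ a w)) (cong (a ⊕_) a⊕w≡v))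

-- Part (b)

weight : ∀ {n} → F2 n → ℕ
weight []          = 0
weight (true ∷ w)  = suc (weight w)
weight (false ∷ w) = weight w

weight≤length : ∀ {n} (w : F2 n) → weight w ≤ n
weight≤length []          = z≤n
weight≤length (true ∷ w)  = s≤s (weight≤length w)
weight≤length (false ∷ w) = ≤-trans (weight≤length w) (n≤1+n _)

weight-⊕ : ∀ {n} (a b : F2 n) → weight (a ⊕ b) ≤ weight a + weight b
weight-⊕ []          []          = z≤n
weight-⊕ (true ∷ a)  (true ∷ b)  = ≤-trans (weight-⊕ a b) (+-mono-≤ (n≤1+n _) (n≤1+n _))
weight-⊕ (true ∷ a)  (false ∷ b) = s≤s (weight-⊕ a b)
weight-⊕ (false ∷ a) (true ∷ b)  = ≤-trans (s≤s (weight-⊕ a b)) (≤-reflexive (sym (+-suc (weight a) (weight b))))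
weight-⊕ (false ∷ a) (false ∷ b) = weight-⊕ a b

weight-zeroV : ∀ n → weight (zeroV {n}) ≡ 0
weight-zeroV zero    = refl
weight-zeroV (suc n) = weight-zeroV n

tabulate-false : ∀ n → Vec.tabulate {n = n} (λ _ → false) ≡ zeroV
tabulate-false zero    = refl
tabulate-false (suc n) = cong (false ∷_) (tabulate-false n)

weight-basis : ∀ {n} (j : Fin n) → weight (basis j) ≡ 1
weight-basis {suc n} zero    = cong suc (trans (cong weight (tabulate-false n)) (weight-zeroV n))
weight-basis {suc n} (suc j) = weight-basis j

weight-ZeroOrBasis : ∀ {n} {w : F2 n} → ZeroOrBasis w → weight w ≤ 1
weight-ZeroOrBasis {n} (inj₁ refl)      = ≤-trans (≤-reflexive (weight-zeroV n)) z≤n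
weight-ZeroOrBasis     (inj₂ (j , refl)) = ≤-reflexive (weight-basis j)

weight-vsum : ∀ {n} k (f : Fin k → F2 n) → (∀ i → ZeroOrBasis (f i)) → weight (vsum k f) ≤ k
weight-vsum {n} zero    f _  = ≤-reflexive (weight-zeroV n)
weight-vsum     (suc k) f zb = ≤-trans (weight-⊕ (f zero) (vsum k (f ∘ suc)))
                                       (+-mono-≤ (weight-ZeroOrBasis (zb zero)) (weight-vsum k (f ∘ suc) (zb ∘ suc)))

ones : ∀ n → F2 n
ones n = replicate n true

weight-ones : ∀ n → weight (ones n) ≡ n
weight-ones zero    = refl
weight-ones (suc n) = cong suc (weight-ones n)

weight≡length⇒ones : ∀ {n} (w : F2 n) → weight w ≡ n → w ≡ ones n
weight≡length⇒ones []          _ = refl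
weight≡length⇒ones (true ∷ w)  e = cong (true ∷_) (weight≡length⇒ones w (suc-injective e))
weight≡length⇒ones {suc n} (false ∷ w) e = ⊥-elim (1+n≰n (subst (_≤ n) e (weight≤length w)))

vsum-false∷ : ∀ {n} k (f : Fin k → F2 n) → vsum k (λ i → false ∷ f i) ≡ false ∷ vsum k f
vsum-false∷ zero    f = refl
vsum-false∷ (suc k) f = cong ((false ∷ f zero) ⊕_) (vsum-false∷ k (f ∘ suc))

basis₀⊕false∷ : ∀ {n} (w : F2 n) → basis zero ⊕ (false ∷ w) ≡ true ∷ w
basis₀⊕false∷ {n} w = cong (true ∷_) (trans (cong (_⊕ w) (tabulate-false n)) (⊕-identityˡ w))

vsum-basis : ∀ n → vsum n (basis {n}) ≡ ones n
vsum-basis zero    = refl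
vsum-basis (suc n) = begin
  basis zero ⊕ vsum n (λ j → false ∷ basis j)  ≡⟨ cong (basis zero ⊕_) (vsum-false∷ n basis) ⟩
  basis zero ⊕ (false ∷ vsum n basis)          ≡⟨ basis₀⊕false∷ (vsum n basis) ⟩
  true ∷ vsum n basis                          ≡⟨ cong (true ∷_) (vsum-basis n) ⟩
  ones (suc n)                                 ∎
  where open ≡-Reasoning

false∷-ZeroOrBasis : ∀ {n} {w : F2 n} → ZeroOrBasis w → ZeroOrBasis (false ∷ w)
false∷-ZeroOrBasis (inj₁ refl)      = inj₁ refl
false∷-ZeroOrBasis (inj₂ (j , refl)) = inj₂ (suc j , refl)

sumOfUnitVectors : ∀ {n} (w : F2 n) k → weight w ≤ k → Sumset k (λ _ → ZeroOrBasis) w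
sumOfUnitVectors []          k       _ = (λ _ → []) , (λ _ → inj₁ refl) , ≡[] (vsum k (λ _ → []))
  where
  ≡[] : (x : F2 0) → x ≡ []
  ≡[] [] = refl
sumOfUnitVectors (false ∷ w) k       w≤k with sumOfUnitVectors w k w≤k
... | f , zb , vsum≡ = (λ i → false ∷ f i) , false∷-ZeroOrBasis ∘ zb , trans (vsum-false∷ k f) (cong (false ∷_) vsum≡)
sumOfUnitVectors (true ∷ w)  (suc k) (s≤s w≤k) with sumOfUnitVectors w k w≤k
... | f , zb , vsum≡ = basis zero Vector.∷ (λ i → false ∷ f i) , zb' ,
    trans (cong (basis zero ⊕_) (vsum-false∷ k f)) (trans (basis₀⊕false∷ (vsum k f)) (cong (true ∷_) vsum≡))
  where
  zb' : ∀ i → ZeroOrBasis ((basis zero Vector.∷ (λ i → false ∷ f i)) i)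
  zb' zero    = inj₂ (zero , refl)
  zb' (suc i) = false∷-ZeroOrBasis (zb i)

partB : ∀ n → 1 ≤ n → Sumset (n ∸ 1) (λ _ → ZeroOrBasis) ≐ AllBut (vsum n basis)
partB (suc n) _ w = missesOnes , coversRest
  where
  missesOnes : Sumset n (λ _ → ZeroOrBasis) w → w ≢ vsum (suc n) basis
  missesOnes (f , zb , refl) vsum≡ = 1+n≰n (subst (_≤ n) weight≡ (weight-vsum n f zb))
    where
    weight≡ : weight (vsum n f) ≡ suc n
    weight≡ = trans (cong weight (trans vsum≡ (vsum-basis (suc n)))) (weight-ones (suc n))
  coversRest : w ≢ vsum (suc n) basis → Sumset n (λ _ → ZeroOrBasis) w
  coversRest w≢ with m≤n⇒m<n∨m≡n (weight≤length w)
  ... | inj₁ w<1+n = sumOfUnitVectors w n (≤-pred w<1+n)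
  ... | inj₂ weight≡ = ⊥-elim (w≢ (trans (weight≡length⇒ones w weight≡) (sym (vsum-basis (suc n)))))

theoremA3 : (n : ℕ) → 1 ≤ n →
    ((t : ℕ) (S : Fin t → Subset n) → ((i : Fin t) → AtLeastTwo (S i)) →
      Σ (F2 n) (λ v → Sumset t S ≐ AllBut v) → t ≤ n ∸ 1)
  × (Sumset (n ∸ 1) (λ _ → ZeroOrBasis) ≐ AllBut (vsum n basis))
theoremA3 n 1≤n = partA n , partB n 1≤n
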